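{- Let $(M,d)$ be a metric space, $\mathsf P\subseteq M$ a set of $n$ points, $1\le\ell\le k\le n$ integers, $m=\lfloor k/\ell\rfloor\ge2$. Let $Q=\{\mathsf q_1,\dots,\mathsf q_m\}$ be the output of Gonzalez's algorithm on $(\mathsf P,m)$. Let $C\subseteq\mathsf P$ with $|C|=k$ and $\bigcup_{i=1}^m N_\ell(\mathsf P,\mathsf q_i)\subseteq C$, $r_{\mathrm{alg}}=\max_{p\in\mathsf P}d_\ell(C,p)$, and let $C^*\subseteq\mathsf P$, $|C^*|=k$, be an optimal fault-tolerant $k$-center solution with cost $r_{\mathrm{opt}}=\max_{p\in\mathsf P}d_\ell(C^*,p)=\min_{C'\subseteq\mathsf P,|C'|=k}\max_{p\in\mathsf P}d_\ell(C',p)$. If $r_{\mathrm{alg}}>3r_{\mathrm{opt}}$, then for any $1\le i\ne j\le m$ the closed balls $B(\mathsf q_i,r_{\mathrm{opt}})$ and $B(\mathsf q_j,r_{\mathrm{opt}})$ are disjoint, and each contains at least $\ell$ points of $C^*$.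
   Context: For a finite $S\subseteq M$, $p\in M$ and integer $1\le i\le |S|$, $d_i(S,p)$ denotes the radius of the smallest closed ball centered at $p$ containing at least $i$ points of $S$. Nearest neighbors are made unique by ordering points $p_j$ of $S$ lexicographically by $(d(p,p_j),j)$; $N_i(S,p)$ is the set of the $i$ nearest neighbors of $p$ in $S$ in this order. $B(x,r)$ is the closed ball of radius $r$ centered at $x$. Gonzalez's algorithm on $(\mathsf P,m)$: set $\mathsf q_1$ to be an arbitrary point of $\mathsf P$; for $i=2,\dots,m$, let $\mathsf q_i$ be a point of $\mathsf P$ maximizing $d_1(\{\mathsf q_1,\dots,\mathsf q_{i-1}\},\cdot)$ over $\mathsf P$; output $Q=\{\mathsf q_1,\dots,\mathsf q_m\}$. -}

module Defs where

open import Level using (0ℓ)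
open import Data.Nat using (ℕ)
open import Data.Fin using (Fin; toℕ)
import Data.Nat as ℕ
open import Data.Fin.Subset using (Subset; _∈_; _∉_; ∣_∣)
open import Data.Product using (Σ; ∃; _×_; _,_)
open import Data.Sum using (_⊎_)
open import Relation.Binary.PropositionalEquality using (_≡_; _≢_)
open import Relation.Nullary using (¬_)
open import Function.Definitions using (Injective)

-- Distance values: a totally ordered abelian group (ℝ is an instance).
record OrderedAbelianGroup : Set₁ where
  infixl 6 _+_
  infix 4 _≤_
  field
    Carrier   : Set
    0#        : Carrier
    _+_       : Carrier → Carrier → Carrier
    -_        : Carrier → Carrier
    _≤_       : Carrier → Carrier → Set
    +-assoc   : ∀ x y z → (x + y) + z ≡ x + (y + z)
    +-comm    : ∀ x y → x + y ≡ y + x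
    +-identityˡ : ∀ x → 0# + x ≡ x
    -‿inverseˡ : ∀ x → (- x) + x ≡ 0#
    ≤-refl    : ∀ x → x ≤ x
    ≤-trans   : ∀ {x y z} → x ≤ y → y ≤ z → x ≤ z
    ≤-antisym : ∀ {x y} → x ≤ y → y ≤ x → x ≡ y
    ≤-total   : ∀ x y → x ≤ y ⊎ y ≤ x
    +-monoˡ-≤ : ∀ {x y} z → x ≤ y → x + z ≤ y + z

  _<_ : Carrier → Carrier → Set
  x < y = x ≤ y × x ≢ y

record IsMetric (V : OrderedAbelianGroup) {M : Set} (d : M → M → OrderedAbelianGroup.Carrier V) : Set where
  open OrderedAbelianGroup V
  field
    zero⇒eq  : ∀ x y → d x y ≡ 0# → x ≡ y
    eq⇒zero  : ∀ x → d x x ≡ 0#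
    sym      : ∀ x y → d x y ≡ d y x
    triangle : ∀ x y z → d x z ≤ d x y + d y z

module Metric (V : OrderedAbelianGroup) {M : Set}
              (d : M → M → OrderedAbelianGroup.Carrier V)
              {n : ℕ} (P : Fin n → M) where
  open OrderedAbelianGroup V

  AtLeast : ℕ → (Fin n → Set) → M → Carrier → Set
  AtLeast i S x r = Σ (Fin i → Fin n) λ f →
    Injective _≡_ _≡_ f × (∀ a → S (f a) × d x (P (f a)) ≤ r)

  IsDist : ℕ → (Fin n → Set) → M → Carrier → Set
  IsDist i S x r = AtLeast i S x r × (∀ r' → AtLeast i S x r' → r ≤ r')

  IsCost : ℕ → Subset n → Carrier → Set
  IsCost ℓ C r =
    (∀ p → ∃ λ rp → IsDist ℓ (_∈ C) (P p) rp × rp ≤ r)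
    × ∃ λ p → IsDist ℓ (_∈ C) (P p) r

  IsOptimal : ℕ → ℕ → Subset n → Carrier → Set
  IsOptimal k ℓ C r = ∣ C ∣ ≡ k × IsCost ℓ C r
    × (∀ C' r' → ∣ C' ∣ ≡ k → IsCost ℓ C' r' → r ≤ r')

  _≺[_]_ : Fin n → M → Fin n → Set
  j ≺[ q ] j' = d q (P j) < d q (P j')
              ⊎ (d q (P j) ≡ d q (P j') × toℕ j ℕ.< toℕ j')

  IsNN : ℕ → M → Subset n → Set
  IsNN ℓ q T = ∣ T ∣ ≡ ℓ × (∀ j j' → j ∈ T → j' ∉ T → j ≺[ q ] j')

  Prefix : {m : ℕ} → (Fin m → Fin n) → Fin m → Fin n → Set
  Prefix g i t = ∃ λ j → toℕ j ℕ.< toℕ i × g j ≡ t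

  -- q = P ∘ g is a possible output of Gonzalez's algorithm on (P , m):
  -- q_1 arbitrary, q_i maximises d_1({q_1..q_{i-1}} , ·) over P for i ≥ 2.
  IsGonzalez : (m : ℕ) → (Fin m → Fin n) → Set
  IsGonzalez m g = ∀ i → 1 ℕ.≤ toℕ i → ∀ p a b →
    IsDist 1 (Prefix g i) (P p) a → IsDist 1 (Prefix g i) (P (g i)) b → a ≤ b

-- If the balls of radius r_opt around a centre q_j and a later centre q_i
-- met, then d(q_i, q_j) ≤ 2 r_opt, so by the Gonzalez choice of q_i every
-- point p lies within 2 r_opt of some earlier centre q_k.  The ball of radius
-- r_opt around q_k contains ℓ points of C*, so it also contains the ℓ
-- nearest neighbours of q_k, which lie in C.  Thus d_ℓ(C, p) ≤ 3 r_opt for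
-- every p, contradicting r_alg > 3 r_opt.  The second claim is just the cost
-- bound of C* at the centres.
--
-- Nearest-neighbour sets are built by repeatedly adding a ≺-least outside
-- point, which needs equality of distances to be decidable; since the claim
-- is a negation, this decidability may be assumed in the double-negation
-- monad.
module Submission where

open import Defs
open import Data.Nat using (ℕ; NonZero; zero; suc; z≤n; s≤s)
import Data.Nat as ℕ
import Data.Nat.Properties as ℕₚ
open import Data.Nat.DivMod using (_/_)
open import Data.Fin using (Fin; zero; suc; toℕ)
import Data.Fin.Properties as Finₚ
open import Data.Fin.Subset using (Subset; _⊆_; _∈_; _∉_; ∣_∣; ⊥; ⊤; ⁅_⁆; _∪_; inside; outside)
open import Data.Fin.Subset.Properties
  using (_∈?_; ∉⊥; ∣⊥∣≡0; ∣⊤∣≡n; p⊆q⇒∣p∣≤∣q∣; ∪-identityʳ; x∈⁅x⁆; x∈⁅y⁆⇒x≡y; x∈p∪q⁻; x∈p∪q⁺)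
open import Data.Vec using (_∷_; here; there)
import Data.Vec.Functional as Vector
open import Data.Product using (∃; _×_; _,_; proj₁; proj₂)
open import Data.Sum using (_⊎_; inj₁; inj₂; reduce)
open import Data.Empty using (⊥-elim)
open import Function using (_∘_; _on_)
open import Function.Definitions using (Injective)
open import Effect.Monad using (RawMonad)
open import Relation.Nullary using (¬_; Dec; yes; no; ¬?; contradiction)
open import Relation.Nullary.Decidable using (¬¬-excluded-middle; decidable-stable)
open import Relation.Nullary.Negation using (¬¬-Monad; ¬¬-map)
open import Relation.Unary using (Pred; Decidable)
open import Relation.Binary using (Rel; Transitive; Total; tri<; tri≈; tri>)
open import Relation.Binary.Construct.Closure.Reflexive using (ReflClosure; refl; [_])
import Relation.Binary.Construct.Closure.Reflexive.Properties as ReflClosure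
open import Data.Product.Relation.Binary.Lex.Strict using (×-transitive)
open import Relation.Binary.PropositionalEquality
  using (_≡_; _≢_; refl; sym; cong; subst; subst₂; resp₂; isEquivalence)

least : ∀ {n a b} {_≼_ : Rel (Fin n) a} → Transitive _≼_ → Total _≼_ →
        {U : Pred (Fin n) b} → Decidable U →
        (∀ j → ¬ U j) ⊎ ∃ λ m → U m × (∀ {j} → U j → m ≼ j)
least {zero} _ _ _ = inj₁ λ ()
least {suc _} trans total U? with least trans (λ a b → total (suc a) (suc b)) (U? ∘ suc) | U? zero
... | inj₁ none | no ¬u₀ =
  inj₁ λ { zero → ¬u₀ ; (suc j) → none j }
... | inj₁ none | yes u₀ =
  inj₂ (zero , u₀ , λ { {zero} _ → reduce (total zero zero) ; {suc j} uj → ⊥-elim (none j uj) })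
... | inj₂ (m , um , min) | no ¬u₀ =
  inj₂ (suc m , um , λ { {zero} u₀ → contradiction u₀ ¬u₀ ; {suc j} uj → min uj })
... | inj₂ (m , um , min) | yes u₀ with total zero (suc m)
...   | inj₁ 0≼m =
  inj₂ (zero , u₀ , λ { {zero} _ → reduce (total zero zero) ; {suc j} uj → trans 0≼m (min uj) })
...   | inj₂ m≼0 =
  inj₂ (suc m , um , λ { {zero} _ → m≼0 ; {suc j} uj → min uj })

∣p∪⁅x⁆∣≡1+∣p∣ : ∀ {n} {p : Subset n} {x : Fin n} → x ∉ p → ∣ p ∪ ⁅ x ⁆ ∣ ≡ suc ∣ p ∣
∣p∪⁅x⁆∣≡1+∣p∣ {p = outside ∷ p} {zero}  _   = cong (suc ∘ ∣_∣) (∪-identityʳ p)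
∣p∪⁅x⁆∣≡1+∣p∣ {p = inside  ∷ p} {zero}  x∉p = contradiction here x∉p
∣p∪⁅x⁆∣≡1+∣p∣ {p = outside ∷ p} {suc x} x∉p = ∣p∪⁅x⁆∣≡1+∣p∣ (x∉p ∘ there)
∣p∪⁅x⁆∣≡1+∣p∣ {p = inside  ∷ p} {suc x} x∉p = cong suc (∣p∪⁅x⁆∣≡1+∣p∣ (x∉p ∘ there))

record InitialSegment {n a} (_≺_ : Rel (Fin n) a) (s : ℕ) : Set a where
  field
    members        : Subset n
    size           : ∣ members ∣ ≡ s
    precedes       : ∀ j j' → j ∈ members → j' ∉ members → j ≺ j'
    enum           : Fin s → Fin n
    enum-injective : Injective _≡_ _≡_ enum
    enum-∈         : ∀ t → enum t ∈ members

module Seg = InitialSegment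

n≤∣p∣ : ∀ {n} {p : Subset n} → (∀ j → ¬ j ∉ p) → n ℕ.≤ ∣ p ∣
n≤∣p∣ {n} {p} full =
  subst (ℕ._≤ ∣ p ∣) (∣⊤∣≡n n) (p⊆q⇒∣p∣≤∣q∣ {p = ⊤} λ {j} _ → decidable-stable (j ∈? p) (full j))

module _ {n a} {_≺_ : Rel (Fin n) a} (≺-trans : Transitive _≺_) (≼-total : Total (ReflClosure _≺_)) where

  addLeast : ∀ {s} (N : InitialSegment _≺_ s) {m} → m ∉ Seg.members N →
             (∀ {j} → j ∉ Seg.members N → ReflClosure _≺_ m j) → InitialSegment _≺_ (suc s)
  addLeast N {m} m∉ m-least = record
    { members        = members ∪ ⁅ m ⁆
    ; size           = subst (λ c → ∣ members ∪ ⁅ m ⁆ ∣ ≡ suc c) size (∣p∪⁅x⁆∣≡1+∣p∣ m∉)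
    ; precedes       = precedes′
    ; enum           = m Vector.∷ enum
    ; enum-injective = injective
    ; enum-∈         = λ { zero → x∈p∪q⁺ (inj₂ (x∈⁅x⁆ m)) ; (suc t) → x∈p∪q⁺ (inj₁ (enum-∈ t)) }
    }
    where
    open InitialSegment N
    precedes′ : ∀ j j' → j ∈ members ∪ ⁅ m ⁆ → j' ∉ members ∪ ⁅ m ⁆ → j ≺ j'
    precedes′ j j' j∈ j'∉ with x∈p∪q⁻ members ⁅ m ⁆ j∈ | m-least {j'} (j'∉ ∘ x∈p∪q⁺ ∘ inj₁)
    ... | inj₁ j∈members | _      = precedes j j' j∈members (j'∉ ∘ x∈p∪q⁺ ∘ inj₁)
    ... | inj₂ _         | refl   = contradiction (x∈p∪q⁺ (inj₂ (x∈⁅x⁆ m))) j'∉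
    ... | inj₂ j∈⁅m⁆     | [ m≺ ] = subst (_≺ j') (sym (x∈⁅y⁆⇒x≡y m j∈⁅m⁆)) m≺
    injective : Injective _≡_ _≡_ (m Vector.∷ enum)
    injective {zero}  {zero}  _  = refl
    injective {zero}  {suc u} eq = contradiction (subst (_∈ members) (sym eq) (enum-∈ u)) m∉
    injective {suc t} {zero}  eq = contradiction (subst (_∈ members) eq (enum-∈ t)) m∉
    injective {suc t} {suc u} eq = cong suc (enum-injective eq)

  extendSegment : ∀ {s} → s ℕ.< n → InitialSegment _≺_ s → InitialSegment _≺_ (suc s)
  extendSegment s<n N with least (ReflClosure.trans ≺-trans) ≼-total (λ j → ¬? (j ∈? Seg.members N))
  ... | inj₁ full               = contradiction (subst (n ℕ.≤_) (Seg.size N) (n≤∣p∣ full)) (ℕₚ.<⇒≱ s<n)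
  ... | inj₂ (m , m∉ , m-least) = addLeast N m∉ m-least

  initialSegment : ∀ {s} → s ℕ.≤ n → InitialSegment _≺_ s
  initialSegment {zero} _ = record
    { members        = ⊥
    ; size           = ∣⊥∣≡0 n
    ; precedes       = λ _ _ j∈⊥ _ → contradiction j∈⊥ ∉⊥
    ; enum           = λ ()
    ; enum-injective = λ { {()} }
    ; enum-∈         = λ ()
    }
  initialSegment {suc s} s<n = extendSegment s<n (initialSegment (ℕₚ.<⇒≤ s<n))

module _ (V : OrderedAbelianGroup) where
  open OrderedAbelianGroup V

  +-monoʳ-≤ : ∀ {x y} z → x ≤ y → z + x ≤ z + y
  +-monoʳ-≤ {x} {y} z x≤y = subst₂ _≤_ (+-comm x z) (+-comm y z) (+-monoˡ-≤ z x≤y)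

  +-mono-≤ : ∀ {x y u v} → x ≤ y → u ≤ v → x + u ≤ y + v
  +-mono-≤ {y = y} x≤y u≤v = ≤-trans (+-monoˡ-≤ _ x≤y) (+-monoʳ-≤ y u≤v)

  <-trans : Transitive _<_
  <-trans (x≤y , x≢y) (y≤z , y≢z) =
    ≤-trans x≤y y≤z , λ { refl → x≢y (≤-antisym x≤y y≤z) }

  <⇒≱ : ∀ {x y} → x < y → ¬ (y ≤ x)
  <⇒≱ (x≤y , x≢y) y≤x = x≢y (≤-antisym x≤y y≤x)

module Gonzalez (V : OrderedAbelianGroup) {M : Set} (d : M → M → OrderedAbelianGroup.Carrier V)
                (metric : IsMetric V d) {n : ℕ} (P : Fin n → M) where
  open OrderedAbelianGroup V
  open IsMetric metric renaming (sym to d-sym)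
  open Metric V d P

  ≺-trans : (q : M) → Transitive (_≺[ q ]_)
  ≺-trans q {a} {b} {c} = ×-transitive {_<₁_ = _<_} {_<₂_ = ℕ._<_}
    isEquivalence (resp₂ _<_) (<-trans V) ℕₚ.<-trans
    {d q (P a) , toℕ a} {d q (P b) , toℕ b} {d q (P c) , toℕ c}

  ≺⇒≤ : (q : M) → ∀ {a b} → a ≺[ q ] b → d q (P a) ≤ d q (P b)
  ≺⇒≤ q     (inj₁ (a≤b , _)) = a≤b
  ≺⇒≤ q {a} (inj₂ (a≡b , _)) = subst (d q (P a) ≤_) a≡b (≤-refl _)

  DecidableDistances : M → Set
  DecidableDistances q = ∀ a b → Dec (d q (P a) ≡ d q (P b))

  ¬¬-decidableDistances : (q : M) → ¬ ¬ DecidableDistances q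
  ¬¬-decidableDistances q =
    Finₚ.sequence rawApplicative λ a → Finₚ.sequence rawApplicative λ b → ¬¬-excluded-middle
    where open RawMonad ¬¬-Monad using (rawApplicative)

  ≼-total : (q : M) → DecidableDistances q → Total (ReflClosure (_≺[ q ]_))
  ≼-total q _≟_ a b with a ≟ b | ≤-total (d q (P a)) (d q (P b))
  ... | no a≢b | inj₁ a≤b = inj₁ [ inj₁ (a≤b , a≢b) ]
  ... | no a≢b | inj₂ b≤a = inj₂ [ inj₁ (b≤a , a≢b ∘ sym) ]
  ... | yes a≡b | _ with ℕₚ.<-cmp (toℕ a) (toℕ b)
  ...   | tri< a<b _ _ = inj₁ [ inj₂ (a≡b , a<b) ]
  ...   | tri≈ _ a≡b′ _ = inj₁ (subst (ReflClosure _ a) (Finₚ.toℕ-injective a≡b′) refl)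
  ...   | tri> _ _ b<a = inj₂ [ inj₂ (sym a≡b , b<a) ]

  atLeast-⊆ : ∀ {ℓ S S′ x r} → (∀ {j} → S j → S′ j) → AtLeast ℓ S x r → AtLeast ℓ S′ x r
  atLeast-⊆ S⊆S′ (f , f-inj , near) = f , f-inj , λ t → S⊆S′ (proj₁ (near t)) , proj₂ (near t)

  atLeast-mono : ∀ {ℓ S x r r′} → r ≤ r′ → AtLeast ℓ S x r → AtLeast ℓ S x r′
  atLeast-mono r≤r′ (f , f-inj , near) = f , f-inj , λ t → proj₁ (near t) , ≤-trans (proj₂ (near t)) r≤r′

  atLeast-shift : ∀ {ℓ S y r} x → AtLeast ℓ S y r → AtLeast ℓ S x (d x y + r)
  atLeast-shift {y = y} x (f , f-inj , near) = f , f-inj , λ t →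
    proj₁ (near t) , ≤-trans (triangle x y (P (f t))) (+-monoʳ-≤ V (d x y) (proj₂ (near t)))

  atLeast₁ : ∀ {S x r t} → S t → d x (P t) ≤ r → AtLeast 1 S x r
  atLeast₁ {t = t} St near = (λ _ → t) , (λ { {zero} {zero} _ → refl }) , λ _ → St , near

  cost-atLeast : ∀ {ℓ C r} → IsCost ℓ C r → ∀ p → AtLeast ℓ (_∈ C) (P p) r
  cost-atLeast {C = C} (bounded , _) p with bounded p
  ... | rₚ , (atLeastₚ , _) , rₚ≤r = atLeast-mono {S = _∈ C} rₚ≤r atLeastₚ

  atLeast-initialSegment : ∀ {ℓ S r} q (N : InitialSegment (_≺[ q ]_) ℓ) →
    AtLeast ℓ S q r → AtLeast ℓ (_∈ Seg.members N) q r
  atLeast-initialSegment q N (f , f-inj , near) with Finₚ.any? (λ t → ¬? (f t ∈? Seg.members N))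
  ... | no none = f , f-inj , λ t →
    decidable-stable (f t ∈? Seg.members N) (λ ft∉ → none (t , ft∉)) , proj₂ (near t)
  ... | yes (t₀ , ft₀∉) = Seg.enum N , Seg.enum-injective N , λ t →
    Seg.enum-∈ N t , ≤-trans (≺⇒≤ q (Seg.precedes N _ _ (Seg.enum-∈ N t) ft₀∉)) (proj₂ (near t₀))

  atLeast-nearestNeighbours : ∀ {ℓ S C r} q → ℓ ℕ.≤ n → (∀ T → IsNN ℓ q T → T ⊆ C) →
    AtLeast ℓ S q r → ¬ ¬ AtLeast ℓ (_∈ C) q r
  atLeast-nearestNeighbours {ℓ} {S} {C} q ℓ≤n NN⊆C near = ¬¬-map within (¬¬-decidableDistances q)
    where
    within : DecidableDistances q → AtLeast ℓ (_∈ C) q _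
    within _≟_ = atLeast-⊆ {S = _∈ Seg.members N} {S′ = _∈ C}
      (NN⊆C _ (Seg.size N , Seg.precedes N)) (atLeast-initialSegment {S = S} q N near)
      where
      N : InitialSegment (_≺[ q ]_) ℓ
      N = initialSegment (≺-trans q) (≼-total q _≟_) ℓ≤n

  prefix-dist₁ : ∀ {m} (g : Fin m → Fin n) {i j : Fin m} → toℕ j ℕ.< toℕ i → (x : M) →
    ∃ λ k → toℕ k ℕ.< toℕ i × IsDist 1 (Prefix g i) x (d x (P (g k)))
  prefix-dist₁ g {i} {j} j<i x
    with least {_≼_ = _≤_ on λ t → d x (P (g t))} ≤-trans (λ a b → ≤-total _ _) (λ t → toℕ t ℕ.<? toℕ i)
  ... | inj₁ none = contradiction j<i (none j)
  ... | inj₂ (k , k<i , k-least) =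
    k , k<i , atLeast₁ {S = Prefix g i} (k , k<i , refl) (≤-refl _) , minimal
    where
    minimal : ∀ r → AtLeast 1 (Prefix g i) x r → d x (P (g k)) ≤ r
    minimal r (f , _ , near) with near zero
    ... | (t , t<i , gt≡f₀) , f₀-near =
      ≤-trans (k-least t<i) (subst (λ u → d x (P u) ≤ r) (sym gt≡f₀) f₀-near)

  gonzalez-cover : ∀ {m} {g : Fin m → Fin n} → IsGonzalez m g → ∀ {i j r} → toℕ j ℕ.< toℕ i →
    d (P (g i)) (P (g j)) ≤ r → ∀ p → ∃ λ k → d (P p) (P (g k)) ≤ r
  gonzalez-cover {g = g} gonzalez {i} {j} j<i close p
    with prefix-dist₁ g j<i (P p) | prefix-dist₁ g j<i (P (g i))
  ... | k , _ , distₚ | _ , _ , distᵢ =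
    k , ≤-trans (gonzalez i (ℕₚ.≤-trans (s≤s z≤n) j<i) p _ _ distₚ distᵢ)
                (proj₂ distᵢ _ (atLeast₁ {S = Prefix g i} (j , j<i , refl) close))

  meeting-balls : ∀ {x y z r} → d x y ≤ r → d x z ≤ r → d y z ≤ r + r
  meeting-balls {x} {y} {z} xy xz =
    ≤-trans (triangle y x z) (+-mono-≤ V (subst (_≤ _) (d-sym x y) xy) xz)

  later-ball-disjoint : ∀ {ℓ m} {g : Fin m → Fin n} {C Cstar ralg ropt} → ℓ ℕ.≤ n → IsGonzalez m g →
    (∀ i T → IsNN ℓ (P (g i)) T → T ⊆ C) → IsCost ℓ C ralg → IsCost ℓ Cstar ropt →
    (ropt + ropt + ropt) < ralg →
    ∀ {i j} → toℕ j ℕ.< toℕ i → ∀ x → ¬ (d x (P (g i)) ≤ ropt × d x (P (g j)) ≤ ropt)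
  later-ball-disjoint {g = g} {C} {Cstar} ℓ≤n gonzalez NN⊆C (_ , p , distₚ) costStar gap j<i x (xi , xj)
    with gonzalez-cover gonzalez j<i (meeting-balls xi xj) p
  ... | k , p-close =
    atLeast-nearestNeighbours {S = _∈ Cstar} {C = C} (P (g k)) ℓ≤n (NN⊆C k) (cost-atLeast costStar (g k))
      λ near → <⇒≱ V gap
        (≤-trans (proj₂ distₚ _ (atLeast-shift {S = _∈ C} (P p) near)) (+-monoˡ-≤ _ p-close))

  balls-disjoint : ∀ {ℓ m} {g : Fin m → Fin n} {C Cstar ralg ropt} → ℓ ℕ.≤ n → IsGonzalez m g →
    (∀ i T → IsNN ℓ (P (g i)) T → T ⊆ C) → IsCost ℓ C ralg → IsCost ℓ Cstar ropt →
    (ropt + ropt + ropt) < ralg →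
    ∀ i j → i ≢ j → ∀ x → ¬ (d x (P (g i)) ≤ ropt × d x (P (g j)) ≤ ropt)
  balls-disjoint ℓ≤n gonzalez NN⊆C cost costStar gap i j i≢j x (xi , xj) with ℕₚ.<-cmp (toℕ i) (toℕ j)
  ... | tri< i<j _ _ = later-ball-disjoint ℓ≤n gonzalez NN⊆C cost costStar gap i<j x (xj , xi)
  ... | tri≈ _ i≡j _ = i≢j (Finₚ.toℕ-injective i≡j)
  ... | tri> _ _ j<i = later-ball-disjoint ℓ≤n gonzalez NN⊆C cost costStar gap j<i x (xi , xj)

lemma4p11 : (V : OrderedAbelianGroup) → let open OrderedAbelianGroup V in
    {M : Set} (d : M → M → Carrier) → IsMetric V d →
    (n : ℕ) (P : Fin n → M) → Injective _≡_ _≡_ P →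
    (ℓ k m : ℕ) → .{{_ : NonZero ℓ}} → ℓ ℕ.≤ k → k ℕ.≤ n → m ≡ k / ℓ → 2 ℕ.≤ m →
    let open Metric V d P in
    (g : Fin m → Fin n) → IsGonzalez m g →
    (C : Subset n) → ∣ C ∣ ≡ k →
    (∀ i T → IsNN ℓ (P (g i)) T → T ⊆ C) →
    (ralg : Carrier) → IsCost ℓ C ralg →
    (Cstar : Subset n) (ropt : Carrier) → IsOptimal k ℓ Cstar ropt →
    (ropt + ropt + ropt) < ralg →
    (∀ i j → i ≢ j → ∀ x → ¬ (d x (P (g i)) ≤ ropt × d x (P (g j)) ≤ ropt))
    × (∀ i → AtLeast ℓ (_∈ Cstar) (P (g i)) ropt)
lemma4p11 V d metric _ P _ _ _ _ ℓ≤k k≤n _ _ g gonzalez _ _ NN⊆C _ cost _ _ (_ , costStar , _) gap =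
  balls-disjoint (ℕₚ.≤-trans ℓ≤k k≤n) gonzalez NN⊆C cost costStar gap ,
  cost-atLeast costStar ∘ g
  where open Gonzalez V d metric P
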